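{- Transfinite induction holds for $\mathrm{MutualOrd}$: for every universe level $\ell$ and every type family $P : \mathrm{MutualOrd} \to \mathrm{Type}_\ell$, if for every $x : \mathrm{MutualOrd}$ one has $\big(\prod_{y : \mathrm{MutualOrd}} (y < x) \to P(y)\big) \to P(x)$, then $P(x)$ holds for every $x : \mathrm{MutualOrd}$.
   Context: Work in cubical type theory (as implemented in cubical Agda); $x \equiv y$ denotes the path type, $A \uplus B$ the coproduct. $\mathrm{MutualOrd} : \mathrm{Type}_0$ is defined simultaneously (inductive-inductive-recursively) with a relation $<$ on it and a function $\mathrm{fst} : \mathrm{MutualOrd} \to \mathrm{MutualOrd}$: its constructors are $\mathbf{0}$ and, for $a, b : \mathrm{MutualOrd}$ and $r : a \geq \mathrm{fst}(b)$, an element $\omega^a + b\,[r]$, where $a \geq b := (b < a) \uplus (a \equiv b)$. The relation $<$ is generated by: $\mathbf{0} < \omega^a + b\,[r]$; if $a < c$ then $\omega^a + b\,[r] < \omega^c + d\,[s]$; if $a \equiv c$ and $b < d$ then $\omega^a + b\,[r] < \omega^c + d\,[s]$. Finally $\mathrm{fst}(\mathbf{0}) = \mathbf{0}$ and $\mathrm{fst}(\omega^a + b\,[r]) = a$. -}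

module Defs where

open import Level using (Level)
open import Data.Sum using (_⊎_)
open import Relation.Binary.PropositionalEquality using (_≡_)

-- Inductive-inductive-recursive definition of MutualOrd, _<_ and fst,
-- following the paper (Cantor normal forms below ε₀).

data MutualOrd : Set
data _<_ : MutualOrd → MutualOrd → Set
fst : MutualOrd → MutualOrd

_≥_ : MutualOrd → MutualOrd → Set
a ≥ b = (b < a) ⊎ (a ≡ b)

infix 30 _<_ _≥_

data MutualOrd where
  𝟎 : MutualOrd
  ω^_+_[_] : (a b : MutualOrd) → a ≥ fst b → MutualOrd

data _<_ where
  <₁ : ∀ {a b r} → 𝟎 < ω^ a + b [ r ]
  <₂ : ∀ {a b c d r s} → a < c → ω^ a + b [ r ] < ω^ c + d [ s ]
  <₃ : ∀ {a b c d r s} → a ≡ c → b < d → ω^ a + b [ r ] < ω^ c + d [ s ]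

fst 𝟎 = 𝟎
fst ω^ a + _ [ _ ] = a

module Submission where

-- An ordinal ω^ c + d [ s ] lies below a larger one either because
-- its leading exponent is smaller (<₂) or because the exponents agree and
-- its tail is smaller (<₃).  So we prove, simultaneously:
--   * if a is accessible, every x whose leading exponent is ≤ a is
--     accessible (by structural recursion on x), and
--   * if a is accessible, c ≤ a and d is accessible, then ω^ c + d [ s ]
--     is accessible; its predecessors are handled by recursion on the
--     accessibility of a (case <₂) and of d (case <₃).
-- Every ordinal is then accessible by recursion on its leading exponent.

open import Defs
open import Level using (Level)
open import Data.Sum using (inj₁; inj₂)
open import Relation.Binary.PropositionalEquality using (refl)
open import Induction.WellFounded using (Acc; acc; WellFounded; module All)

<-trans : ∀ {a b c} → a < b → b < c → a < c
<-trans <₁            (<₂ _)        = <₁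
<-trans <₁            (<₃ _ _)      = <₁
<-trans (<₂ a<b)      (<₂ b<c)      = <₂ (<-trans a<b b<c)
<-trans (<₂ a<b)      (<₃ refl _)   = <₂ a<b
<-trans (<₃ refl _)   (<₂ b<c)      = <₂ b<c
<-trans (<₃ refl a<b) (<₃ refl b<c) = <₃ refl (<-trans a<b b<c)

≤-<-trans : ∀ {a b c} → b ≥ a → b < c → a < c
≤-<-trans (inj₁ a<b)  b<c = <-trans a<b b<c
≤-<-trans (inj₂ refl) b<c = b<c

<-≤-trans : ∀ {a b c} → a < b → c ≥ b → a < c
<-≤-trans a<b (inj₁ b<c)  = <-trans a<b b<c
<-≤-trans a<b (inj₂ refl) = a<b

≥-trans : ∀ {a b c} → b ≥ a → c ≥ b → c ≥ a
≥-trans a≤b (inj₁ b<c)  = inj₁ (≤-<-trans a≤b b<c)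
≥-trans a≤b (inj₂ refl) = a≤b

acc-𝟎 : Acc _<_ 𝟎
acc-𝟎 = acc λ ()

mutual
  acc-bounded : ∀ {a} → Acc _<_ a → ∀ x → a ≥ fst x → Acc _<_ x
  acc-bounded _     𝟎                _   = acc-𝟎
  acc-bounded acc-a (ω^ c + d [ s ]) c≤a =
    acc-ω acc-a c≤a (acc-bounded acc-a d (≥-trans s c≤a)) s

  acc-ω : ∀ {a c d} → Acc _<_ a → a ≥ c → Acc _<_ d → (s : c ≥ fst d)
        → Acc _<_ (ω^ c + d [ s ])
  acc-ω acc-a c≤a acc-d s = acc (below-ω acc-a c≤a acc-d s)

  -- Everything below such a term is accessible: a term with smaller
  -- exponent e is bounded by the accessible e (case <₂); a term with the
  -- same exponent and smaller tail is again of the form above (case <₃).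
  below-ω : ∀ {a c d} → Acc _<_ a → a ≥ c → Acc _<_ d → (s : c ≥ fst d)
          → ∀ {y} → y < ω^ c + d [ s ] → Acc _<_ y
  below-ω _ _ _ _ <₁ = acc-𝟎
  below-ω (acc below-a) c≤a _ _ {ω^ e + f [ t ]} (<₂ e<c) =
    acc-bounded (below-a (<-≤-trans e<c c≤a)) (ω^ e + f [ t ]) (inj₂ refl)
  below-ω acc-a c≤a (acc below-d) _ {ω^ _ + f [ t ]} (<₃ refl f<d) =
    acc-ω acc-a c≤a (below-d f<d) t

-- Every ordinal is accessible: bound it by its own leading exponent.
<-wellFounded : WellFounded _<_
<-wellFounded 𝟎                = acc-𝟎
<-wellFounded (ω^ c + d [ s ]) =
  acc-bounded (<-wellFounded c) (ω^ c + d [ s ]) (inj₂ refl)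

theorem5p1 : {ℓ : Level} (P : MutualOrd → Set ℓ)
    → ((x : MutualOrd) → ((y : MutualOrd) → y < x → P y) → P x)
    → (x : MutualOrd) → P x
theorem5p1 {ℓ} P step =
  All.wfRec <-wellFounded ℓ P (λ x ih → step x (λ _ y<x → ih y<x))
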